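{- Let $k\geq 2$ be an integer and let $G=(D\cup I,E)$ be a split graph such that its corresponding hypergraph $H(G)$ is not $k$-uniform. Suppose there exists a panchromatic $k$-coloring $\varphi$ of $H(G)$ such that exactly one vertex has a unique color, say color $c_j$, and such that for each color $c_i\neq c_j$ there exists a vertex $y\in I$ with $d_G(y)>k$ that is adjacent to at least two vertices of color $c_i$. Then $G$ has $k$ completely independent spanning trees.
   Context: A split graph $G=(D\cup I,E)$ is a graph whose vertex set is partitioned into a clique $D$ and an independent set $I$; the paper assumes throughout that every vertex of $D$ is adjacent to at least one vertex of $I$. Its corresponding hypergraph is $H(G)=(D,\mathcal{E})$ with $\mathcal{E}=\{N_G(x) : x\in I\}$ (one hyperedge for each $x\in I$); it is $k$-uniform if every vertex of $I$ has exactly $k$ neighbors. $d_G(y)$ is the degree of $y$ in $G$. A panchromatic $k$-coloring of a hypergraph is an assignment of colors from $\{1,\dots,k\}$ to its vertices such that every hyperedge contains at least one vertex of each of the $k$ colors. A color is unique if it is assigned to exactly one vertex. Spanning trees $T_1,\dots,T_k$ of a graph are completely independent spanning trees if for every pair of vertices $x,y$ the $(x,y)$-paths in $T_1,\dots,T_k$ are pairwise edge-disjoint and have no common internal vertex. -}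

module Defs where

open import Data.Nat using (ℕ; _<_; _≤_)
open import Data.Fin using (Fin)
open import Data.Fin.Properties using ()
open import Data.List using (List; []; _∷_; length; filterᵇ; allFin)
open import Data.List.Membership.Propositional using (_∈_)
open import Data.List.Relation.Unary.Unique.Propositional using (Unique)
open import Data.Bool using (Bool; true)
open import Data.Sum using (_⊎_; inj₁; inj₂)
open import Data.Product using (Σ; _×_; ∃; ∃-syntax; _,_)
open import Data.Empty using (⊥)
open import Relation.Nullary using (¬_)
open import Relation.Binary.PropositionalEquality using (_≡_; _≢_)
open import Level using (Level; _⊔_) renaming (suc to lsuc)

data Walk {V : Set} (E : V → V → Set) : V → V → List V → Set where
  stop : ∀ {x} → Walk E x x (x ∷ [])
  step : ∀ {x y z vs} → E x y → Walk E y z vs → Walk E x z (x ∷ vs)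

Path : {V : Set} → (V → V → Set) → V → V → List V → Set
Path E x y vs = Walk E x y vs × Unique vs

data Consec {V : Set} (u v : V) : List V → Set where
  here  : ∀ {vs} → Consec u v (u ∷ v ∷ vs)
  there : ∀ {w vs} → Consec u v vs → Consec u v (w ∷ vs)

EdgeOf : {V : Set} → V → V → List V → Set
EdgeOf u v vs = Consec u v vs ⊎ Consec v u vs

-- A cycle is a path v₀ … vₗ with at least 3 vertices plus the edge vₗ v₀.
record SpanningTree {V : Set} (E : V → V → Set) (T : V → V → Set) : Set where
  field
    sub       : ∀ {x y} → T x y → E x y
    symmetric : ∀ {x y} → T x y → T y x
    connected : ∀ x y → ∃[ vs ] Walk T x y vs
    acyclic   : ∀ x y vs → Path T x y vs → 3 ≤ length vs → ¬ T y x

-- Completely independent spanning trees T₁,…,T_k of (V, E):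
-- all are spanning trees, and for every pair of vertices x, y and
-- i ≠ j, the (x,y)-path in Tᵢ and the (x,y)-path in Tⱼ are
-- edge-disjoint and have no common internal vertex.
-- (In a tree the (x,y)-path is unique, so we quantify over all paths.)
CompletelyIndependent : {V : Set} (k : ℕ) (E : V → V → Set)
  (T : Fin k → V → V → Set) → Set
CompletelyIndependent {V} k E T =
  (∀ i → SpanningTree E (T i)) ×
  (∀ (i j : Fin k) → i ≢ j → ∀ (x y : V) (p q : List V) →
     Path (T i) x y p → Path (T j) x y q →
       (∀ u v → EdgeOf u v p → ¬ EdgeOf u v q) ×
       (∀ w → w ∈ p → w ∈ q → w ≡ x ⊎ w ≡ y))

HasCIST : {V : Set} (k : ℕ) (E : V → V → Set) → Set₁
HasCIST k E = ∃[ T ] CompletelyIndependent k E T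

-- Split graphs.  D = Fin d (clique), I = Fin m (independent set);
-- adj a x = true iff a ∈ D is adjacent to x ∈ I.

SVertex : ℕ → ℕ → Set
SVertex d m = Fin d ⊎ Fin m

SEdge : {d m : ℕ} → (Fin d → Fin m → Bool) → SVertex d m → SVertex d m → Set
SEdge adj (inj₁ a) (inj₁ b) = a ≢ b
SEdge adj (inj₁ a) (inj₂ x) = adj a x ≡ true
SEdge adj (inj₂ x) (inj₁ a) = adj a x ≡ true
SEdge adj (inj₂ x) (inj₂ y) = ⊥

EveryDHasINeighbour : {d m : ℕ} → (Fin d → Fin m → Bool) → Set
EveryDHasINeighbour {d} {m} adj = ∀ (a : Fin d) → ∃[ x ] adj a x ≡ true

-- d_G(x) for x ∈ I: the number of neighbours of x (all lie in D)
degI : {d m : ℕ} → (Fin d → Fin m → Bool) → Fin m → ℕ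
degI {d} adj x = length (filterᵇ (λ a → adj a x) (allFin d))

-- H(G) is k-uniform: every hyperedge N_G(x), x ∈ I, has size k
KUniform : {d m : ℕ} → ℕ → (Fin d → Fin m → Bool) → Set
KUniform {d} {m} k adj = ∀ (x : Fin m) → degI adj x ≡ k

Panchromatic : {d m k : ℕ} → (Fin d → Fin m → Bool) → (Fin d → Fin k) → Set
Panchromatic {d} {m} {k} adj φ =
  ∀ (x : Fin m) (c : Fin k) → ∃[ a ] (adj a x ≡ true × φ a ≡ c)

UniqueColour : {d k : ℕ} → (Fin d → Fin k) → Fin k → Set
UniqueColour {d} φ c = ∃[ a ] (φ a ≡ c × (∀ (b : Fin d) → φ b ≡ c → b ≡ a))

-- All k trees have depth at most two.  Give every vertex of I the unique
-- colour j of a₀.  For i ≢ j, the tree T i is rooted at a vertex left i of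
-- colour i, carries the rest of colour class i directly below it, and hangs
-- every other vertex below an i-coloured neighbour.  T j is rooted at a₀
-- (adjacent to all of I, by panchromaticity), carries I below a₀, and hangs
-- each vertex of D below a₀, except a second i-coloured vertex right i on
-- the hyperedge hub i, which hangs below hub i.  Then the internal vertices
-- of T t are exactly the vertices of colour t, so the trees are completely
-- independent as soon as no edge is used by two trees in opposite
-- directions, which the attachments are chosen to avoid.
module Submission where

open import Defs
open import Data.Bool using (Bool; true; false; not; _xor_)
open import Data.Bool.Properties using (xor-assoc; true-xor)
open import Data.Empty using (⊥-elim)
open import Data.Fin using (Fin) renaming (_≟_ to _≟ᶠ_)
open import Data.Fin.Properties using (_<?_; <-cmp)
open import Data.List using (List; _∷_; _∷ʳ_; length; reverse)
open import Data.List.Properties using (unfold-reverse; length-reverse)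
open import Data.List.Membership.Propositional using (_∈_)
open import Data.List.Relation.Unary.Any using (here; there)
open import Data.List.Relation.Unary.All as All using ()
open import Data.List.Relation.Unary.AllPairs using (_∷_)
open import Data.List.Relation.Unary.Unique.Propositional using (Unique)
import Data.List.Relation.Binary.Permutation.Setoid as Permutation
import Data.List.Relation.Binary.Permutation.Setoid.Properties as PermutationProperties
open import Data.Nat using (ℕ; suc; _≤_; _<_; z≤n; s≤s)
open import Data.Nat.Properties using (<-trans; <-irrefl; ≤-refl; ≤-trans)
open import Data.Product using (_×_; ∃-syntax; _,_; proj₁; proj₂; map₂)
open import Data.Sum using (_⊎_; inj₁; inj₂; swap)
open import Data.Sum.Properties using (≡-dec; inj₁-injective; inj₂-injective)
open import Function using (_∘_)
open import Relation.Binary.Definitions using (DecidableEquality; tri<; tri≈; tri>)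
open import Relation.Binary.PropositionalEquality
  using (_≡_; _≢_; refl; sym; trans; cong; subst; setoid; module ≡-Reasoning)
open import Relation.Nullary using (¬_; yes; no; does; Dec)
open import Relation.Nullary.Decidable using (dec-true; dec-false)

module _ {V : Set} {T : V → V → Set} where

  walk-head∈ : ∀ {x y vs} → Walk T x y vs → x ∈ vs
  walk-head∈ stop       = here refl
  walk-head∈ (step _ _) = here refl

  walk-last∈ : ∀ {x y vs} → Walk T x y vs → y ∈ vs
  walk-last∈ stop       = here refl
  walk-last∈ (step _ w) = there (walk-last∈ w)

  consec⇒edge : ∀ {x y vs u v} → Walk T x y vs → Consec u v vs → T u v
  consec⇒edge (step e stop)       here      = e
  consec⇒edge (step e (step _ _)) here      = e
  consec⇒edge (step _ w)          (there c) = consec⇒edge w c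

  walk-++ : ∀ {x y z vs ws} → Walk T x y vs → Walk T y z ws → ∃[ us ] Walk T x z us
  walk-++ stop       w′ = _ , w′
  walk-++ (step e w) w′ = _ , step e (proj₂ (walk-++ w w′))

  walk-∷ʳ : ∀ {x y z vs} → Walk T x y vs → T y z → Walk T x z (vs ∷ʳ z)
  walk-∷ʳ stop        e = step e stop
  walk-∷ʳ (step e′ w) e = step e′ (walk-∷ʳ w e)

  walk-reverse : (∀ {u v} → T u v → T v u) →
                 ∀ {x y vs} → Walk T x y vs → Walk T y x (reverse vs)
  walk-reverse T-sym stop = stop
  walk-reverse T-sym (step {x = x} {vs = vs} e w) rewrite unfold-reverse x vs =
    walk-∷ʳ (walk-reverse T-sym w) (T-sym e)

Unique-reverse : {V : Set} {vs : List V} → Unique vs → Unique (reverse vs)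
Unique-reverse {V} {vs} =
  PermutationProperties.Unique-resp-↭ (setoid V)
    (Permutation.↭-sym (setoid V) (PermutationProperties.↭-reverse (setoid V) vs))

record ParentTree (V : Set) : Set where
  field
    root          : V
    parent        : V → V
    depth         : V → ℕ
    depth-parent< : ∀ v → v ≢ root → depth (parent v) < depth v

module _ {V : Set} (P : ParentTree V) where

  open ParentTree P

  ChildOf : V → V → Set
  ChildOf u v = u ≢ root × parent u ≡ v

  TreeEdge : V → V → Set
  TreeEdge u v = ChildOf u v ⊎ ChildOf v u

  Internal : V → Set
  Internal v = ∃[ u ] ChildOf u v

  TreeEdge-sym : ∀ {u v} → TreeEdge u v → TreeEdge v u
  TreeEdge-sym = swap

  child-deeper : ∀ {u v} → ChildOf u v → depth v < depth u
  child-deeper (u≢r , refl) = depth-parent< _ u≢r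

  descending : ∀ {p x y vs} → Unique (p ∷ vs) → Walk TreeEdge x y vs →
               ChildOf x p → depth p < depth y
  descending _ stop x↑p = child-deeper x↑p
  descending (p∉ ∷ _) (step (inj₁ (_ , px≡z)) w) (_ , px≡p) =
    ⊥-elim (All.lookup p∉ (there (walk-head∈ w)) (trans (sym px≡p) px≡z))
  descending (_ ∷ u) (step (inj₂ z↑x) w) x↑p =
    <-trans (child-deeper x↑p) (descending u w z↑x)

  no-cycle-through-parent : ∀ {x y vs} → Walk TreeEdge x y vs → Unique vs →
                            3 ≤ length vs → ¬ ChildOf x y
  no-cycle-through-parent stop _ (s≤s ())
  no-cycle-through-parent (step (inj₁ _) stop) _ (s≤s (s≤s ()))
  no-cycle-through-parent (step (inj₁ (_ , px≡z)) (step _ w)) (_ ∷ z∉ ∷ _) _ (_ , px≡y) =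
    All.lookup z∉ (walk-last∈ w) (trans (sym px≡z) px≡y)
  no-cycle-through-parent (step (inj₂ z↑x) w) u _ x↑y =
    <-irrefl refl (<-trans (descending u w z↑x) (child-deeper x↑y))

  acyclic : ∀ x y vs → Path TreeEdge x y vs → 3 ≤ length vs → ¬ TreeEdge y x
  acyclic x y vs (w , u) 3≤ (inj₂ x↑y) = no-cycle-through-parent w u 3≤ x↑y
  acyclic x y vs (w , u) 3≤ (inj₁ y↑x) =
    no-cycle-through-parent (walk-reverse TreeEdge-sym w) (Unique-reverse u)
      (subst (3 ≤_) (sym (length-reverse vs)) 3≤) y↑x

  middle-internal : ∀ {p x q} → p ≢ q → TreeEdge p x → TreeEdge x q → Internal x
  middle-internal _   (inj₁ p↑x)         _                  = _ , p↑x
  middle-internal _   (inj₂ _)           (inj₂ q↑x)         = _ , q↑x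
  middle-internal p≢q (inj₂ (_ , px≡p)) (inj₁ (_ , px≡q)) = ⊥-elim (p≢q (trans (sym px≡p) px≡q))

  interior-internal : ∀ {p x y vs} → Unique (p ∷ vs) → TreeEdge p x → Walk TreeEdge x y vs →
                      ∀ {w} → w ∈ vs → w ≢ y → Internal w
  interior-internal _        _  stop        (here refl) w≢y = ⊥-elim (w≢y refl)
  interior-internal (p∉ ∷ _) px (step xz w) (here refl) _   =
    middle-internal (All.lookup p∉ (there (walk-head∈ w))) px xz
  interior-internal (_ ∷ u)  _  (step xz w) (there w∈)  w≢y = interior-internal u xz w w∈ w≢y

  path-interior-internal : ∀ {x y vs} → Path TreeEdge x y vs →
                           ∀ {w} → w ∈ vs → w ≢ x → w ≢ y → Internal w
  path-interior-internal (stop     , _) (here refl) w≢x _   = ⊥-elim (w≢x refl)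
  path-interior-internal (step _ _ , _) (here refl) w≢x _   = ⊥-elim (w≢x refl)
  path-interior-internal (step xz w , u) (there w∈) _   w≢y = interior-internal u xz w w∈ w≢y

  edgeOf⇒TreeEdge : ∀ {x y vs u v} → Walk TreeEdge x y vs → EdgeOf u v vs → TreeEdge u v
  edgeOf⇒TreeEdge w (inj₁ c) = consec⇒edge w c
  edgeOf⇒TreeEdge w (inj₂ c) = TreeEdge-sym (consec⇒edge w c)

module _ {V : Set} (_≟_ : DecidableEquality V) where

  module _ (P : ParentTree V) where

    open ParentTree P

    walk-to-root : ∀ v → ∃[ vs ] Walk (TreeEdge P) v root vs
    walk-to-root v = go (suc (depth v)) v ≤-refl
      where
      go : ∀ n v → depth v < n → ∃[ vs ] Walk (TreeEdge P) v root vs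
      go (suc n) v (s≤s d≤n) with v ≟ root
      ... | yes refl = _ , stop
      ... | no v≢r   = _ , step (inj₁ (v≢r , refl))
                             (proj₂ (go n (parent v) (≤-trans (depth-parent< v v≢r) d≤n)))

    spanningTree : (E : V → V → Set) → (∀ {u v} → E u v → E v u) →
                   (∀ v → v ≢ root → E v (parent v)) → SpanningTree E (TreeEdge P)
    spanningTree E E-sym parent-edge = record
      { sub       = λ { (inj₁ (v≢r , refl)) → parent-edge _ v≢r
                      ; (inj₂ (v≢r , refl)) → E-sym (parent-edge _ v≢r) }
      ; symmetric = TreeEdge-sym P
      ; connected = λ x y →
          walk-++ (proj₂ (walk-to-root x)) (walk-reverse (TreeEdge-sym P) (proj₂ (walk-to-root y)))
      ; acyclic   = acyclic P
      }

  -- Two trees using an edge in the same direction share its upper end as an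
  -- internal vertex.
  completelyIndependent :
    ∀ {k} (P : Fin k → ParentTree V) (E : V → V → Set) → (∀ {u v} → E u v → E v u) →
    (∀ t v → v ≢ ParentTree.root (P t) → E v (ParentTree.parent (P t) v)) →
    (∀ t s → t ≢ s → ∀ {w} → Internal (P t) w → ¬ Internal (P s) w) →
    (∀ t s → t ≢ s → ∀ {u v} → ChildOf (P t) u v → ¬ ChildOf (P s) v u) →
    CompletelyIndependent k E (λ t → TreeEdge (P t))
  completelyIndependent P E E-sym parent-edge disjoint unreversed =
    (λ t → spanningTree (P t) E E-sym (parent-edge t)) ,
    λ t s t≢s x y p q (wp , up) (wq , uq) →
      (λ u v e₁ e₂ → edge-disjoint t≢s (edgeOf⇒TreeEdge (P t) wp e₁) (edgeOf⇒TreeEdge (P s) wq e₂)) ,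
      λ w w∈p w∈q → vertex-disjoint t≢s (wp , up) (wq , uq) w∈p w∈q
    where
    edge-disjoint : ∀ {t s} → t ≢ s → ∀ {u v} → TreeEdge (P t) u v → ¬ TreeEdge (P s) u v
    edge-disjoint t≢s (inj₁ u↑v) (inj₁ u↑v′) = disjoint _ _ t≢s (_ , u↑v) (_ , u↑v′)
    edge-disjoint t≢s (inj₁ u↑v) (inj₂ v↑u)  = unreversed _ _ t≢s u↑v v↑u
    edge-disjoint t≢s (inj₂ v↑u) (inj₁ u↑v)  = unreversed _ _ t≢s v↑u u↑v
    edge-disjoint t≢s (inj₂ v↑u) (inj₂ v↑u′) = disjoint _ _ t≢s (_ , v↑u) (_ , v↑u′)

    vertex-disjoint : ∀ {t s} → t ≢ s → ∀ {x y p q} →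
                      Path (TreeEdge (P t)) x y p → Path (TreeEdge (P s)) x y q →
                      ∀ {w} → w ∈ p → w ∈ q → w ≡ x ⊎ w ≡ y
    vertex-disjoint {t} {s} t≢s {x} {y} pp pq {w} w∈p w∈q with w ≟ x | w ≟ y
    ... | yes w≡x | _       = inj₁ w≡x
    ... | no _    | yes w≡y = inj₂ w≡y
    ... | no w≢x  | no w≢y  =
      ⊥-elim (disjoint t s t≢s (path-interior-internal (P t) pp w∈p w≢x w≢y)
                               (path-interior-internal (P s) pq w∈q w≢x w≢y))

module ColourClassTrees {V : Set} (_≟_ : DecidableEquality V) {k : ℕ} (κ : V → Fin k)
  (root : Fin k → V) (κ-root : ∀ t → κ (root t) ≡ t)
  (attach : Fin k → V → V) (κ-attach : ∀ t v → κ (attach t v) ≡ t) where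

  parent : Fin k → V → V
  parent t v with κ v ≟ᶠ t
  ... | yes _ = root t
  ... | no  _ = attach t v

  depth : Fin k → V → ℕ
  depth t v with v ≟ root t | κ v ≟ᶠ t
  ... | yes _ | _     = 0
  ... | no  _ | yes _ = 1
  ... | no  _ | no  _ = 2

  parent-outside : ∀ {t v} → κ v ≢ t → parent t v ≡ attach t v
  parent-outside {t} {v} κv≢t with κ v ≟ᶠ t
  ... | yes κv≡t = ⊥-elim (κv≢t κv≡t)
  ... | no _     = refl

  κ-parent : ∀ t v → κ (parent t v) ≡ t
  κ-parent t v with κ v ≟ᶠ t
  ... | yes _ = κ-root t
  ... | no  _ = κ-attach t v

  depth-inside : ∀ {t v} → κ v ≡ t → depth t v ≤ 1
  depth-inside {t} {v} κv≡t with v ≟ root t | κ v ≟ᶠ t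
  ... | yes _ | _        = z≤n
  ... | no  _ | yes _    = s≤s z≤n
  ... | no  _ | no κv≢t = ⊥-elim (κv≢t κv≡t)

  depth-parent< : ∀ t v → v ≢ root t → depth t (parent t v) < depth t v
  depth-parent< t v v≢r with v ≟ root t | κ v ≟ᶠ t
  ... | yes v≡r | _     = ⊥-elim (v≢r v≡r)
  ... | no  _   | yes _ with root t ≟ root t
  ...   | yes _  = s≤s z≤n
  ...   | no r≢r = ⊥-elim (r≢r refl)
  depth-parent< t v v≢r | no _ | no _ = s≤s (depth-inside (κ-attach t v))

  tree : Fin k → ParentTree V
  tree t = record
    { root = root t ; parent = parent t ; depth = depth t ; depth-parent< = depth-parent< t }

  κ-internal : ∀ {t w} → Internal (tree t) w → κ w ≡ t
  κ-internal {t} (u , _ , refl) = κ-parent t u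

  completelyIndependentClasses :
    (E : V → V → Set) → (∀ {u v} → E u v → E v u) →
    (∀ t v → v ≢ root t → κ v ≡ t → E v (root t)) →
    (∀ t v → κ v ≢ t → E v (attach t v)) →
    (∀ t s v → t ≢ s → κ v ≡ t → attach t (attach s v) ≢ v) →
    CompletelyIndependent k E (λ t → TreeEdge (tree t))
  completelyIndependentClasses E E-sym root-edge attach-edge no-2-cycle =
    completelyIndependent _≟_ tree E E-sym parent-edge disjoint unreversed
    where
    parent-edge : ∀ t v → v ≢ root t → E v (parent t v)
    parent-edge t v v≢r with κ v ≟ᶠ t
    ... | yes κv≡t = root-edge t v v≢r κv≡t
    ... | no  κv≢t = attach-edge t v κv≢t

    disjoint : ∀ t s → t ≢ s → ∀ {w} → Internal (tree t) w → ¬ Internal (tree s) w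
    disjoint t s t≢s w-int₁ w-int₂ = t≢s (trans (sym (κ-internal w-int₁)) (κ-internal w-int₂))

    -- A reversed edge u → v in T t, v → u in T s makes u and v of colours
    -- s and t, so both parents come from attach.
    unreversed : ∀ t s → t ≢ s → ∀ {u v} → ChildOf (tree t) u v → ¬ ChildOf (tree s) v u
    unreversed t s t≢s {u} {v} (_ , pu≡v) (_ , pv≡u) = no-2-cycle t s v t≢s κv≡t (begin
        attach t (attach s v) ≡⟨ cong (attach t) (sym (parent-outside κv≢s)) ⟩
        attach t (parent s v) ≡⟨ cong (attach t) pv≡u ⟩
        attach t u            ≡⟨ sym (parent-outside κu≢t) ⟩
        parent t u            ≡⟨ pu≡v ⟩
        v                     ∎)
      where
      open ≡-Reasoning
      κv≡t : κ v ≡ t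
      κv≡t = subst (λ w → κ w ≡ t) pu≡v (κ-parent t u)
      κu≡s : κ u ≡ s
      κu≡s = subst (λ w → κ w ≡ s) pv≡u (κ-parent s v)
      κv≢s : κ v ≢ s
      κv≢s κv≡s = t≢s (trans (sym κv≡t) κv≡s)
      κu≢t : κ u ≢ t
      κu≢t κu≡t = t≢s (trans (sym κu≡t) κu≡s)

TwoNeighboursColoured : ∀ {d m k} → (Fin d → Fin m → Bool) → (Fin d → Fin k) → Fin k → Fin m → Set
TwoNeighboursColoured adj φ i y =
  ∃[ a ] ∃[ b ] (a ≢ b × adj a y ≡ true × adj b y ≡ true × φ a ≡ i × φ b ≡ i)

module SplitGraphTrees {d m k : ℕ} (adj : Fin d → Fin m → Bool) (φ : Fin d → Fin k)
  (panchromatic : Panchromatic adj φ)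
  (j : Fin k) (a₀ : Fin d) (φa₀ : φ a₀ ≡ j) (a₀-only : ∀ b → φ b ≡ j → b ≡ a₀)
  (x₀ : Fin m) (pairs : ∀ i → i ≢ j → ∃[ y ] TwoNeighboursColoured adj φ i y) where

  V : Set
  V = SVertex d m

  E : V → V → Set
  E = SEdge adj

  E-sym : ∀ {u v} → E u v → E v u
  E-sym {inj₁ _} {inj₁ _} a≢b = a≢b ∘ sym
  E-sym {inj₁ _} {inj₂ _} e   = e
  E-sym {inj₂ _} {inj₁ _} e   = e

  a₀-adj : ∀ x → adj a₀ x ≡ true
  a₀-adj x with panchromatic x j
  ... | a , adj-a , φa≡j = subst (λ b → adj b x ≡ true) (a₀-only a φa≡j) adj-a

  -- The values at j are junk (x₀ is any vertex of I), except left j = a₀,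
  -- which makes root uniform.  Abstract, so that case splits on t ≟ᶠ j
  -- elsewhere do not rewrite inside the choice.
  abstract
    choice : ∀ i → Dec (i ≡ j) → Fin m × Fin d × Fin d
    choice i (yes _) = x₀ , a₀ , a₀
    choice i (no i≢j) with pairs i i≢j
    ... | y , a , b , _ = y , a , b

    hub : Fin k → Fin m
    hub i = proj₁ (choice i (i ≟ᶠ j))

    left right : Fin k → Fin d
    left  i = proj₁ (proj₂ (choice i (i ≟ᶠ j)))
    right i = proj₂ (proj₂ (choice i (i ≟ᶠ j)))

    pair : ∀ {i} → i ≢ j → left i ≢ right i × adj (left i) (hub i) ≡ true ×
                            adj (right i) (hub i) ≡ true × φ (left i) ≡ i × φ (right i) ≡ i
    pair {i} i≢j with i ≟ᶠ j
    ... | yes i≡j = ⊥-elim (i≢j i≡j)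
    ... | no i≢j′ with pairs i i≢j′
    ...   | _ , _ , _ , p = p

    left≢right : ∀ {i} → i ≢ j → left i ≢ right i
    left≢right = proj₁ ∘ pair

    left-adj : ∀ {i} → i ≢ j → adj (left i) (hub i) ≡ true
    left-adj = proj₁ ∘ proj₂ ∘ pair

    right-adj : ∀ {i} → i ≢ j → adj (right i) (hub i) ≡ true
    right-adj = proj₁ ∘ proj₂ ∘ proj₂ ∘ pair

    φ-right : ∀ {i} → i ≢ j → φ (right i) ≡ i
    φ-right = proj₂ ∘ proj₂ ∘ proj₂ ∘ proj₂ ∘ pair

    left-j : left j ≡ a₀
    left-j with j ≟ᶠ j
    ... | yes _   = refl
    ... | no j≢j = ⊥-elim (j≢j refl)

    φ-left : ∀ i → φ (left i) ≡ i
    φ-left i with i ≟ᶠ j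
    ... | yes refl = φa₀
    ... | no i≢j with pairs i i≢j
    ...   | _ , _ , _ , p = proj₁ (proj₂ (proj₂ (proj₂ p)))

  κ : V → Fin k
  κ (inj₁ a) = φ a
  κ (inj₂ _) = j

  root : Fin k → V
  root t = inj₁ (left t)

  κ-root : ∀ t → κ (root t) ≡ t
  κ-root = φ-left

  pick : Fin k → Bool → Fin d
  pick i true  = left i
  pick i false = right i

  isLeft : Fin k → Fin d → Bool
  isLeft l u = does (u ≟ᶠ left l)

  -- For colours i ≢ l (both ≢ j), T i joins left l, right l to left i,
  -- right i and T l joins them the other way round; they use the two
  -- complementary perfect matchings of this 4-cycle, and the order of the
  -- colours decides which tree gets which.
  side : Fin k → Fin k → Fin d → Bool
  side i l u with l ≟ᶠ j
  ... | yes _ = false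
  ... | no  _ = does (l <? i) xor isLeft l u

  attachI : Fin k → V → V
  attachI i (inj₁ u) = inj₁ (pick i (side i (φ u) u))
  attachI i (inj₂ x) with x ≟ᶠ hub i
  ... | yes _ = inj₁ (left i)
  ... | no  _ = inj₁ (proj₁ (panchromatic x i))

  attachJ : V → V
  attachJ (inj₁ u) with u ≟ᶠ right (φ u)
  ... | yes _ = inj₂ (hub (φ u))
  ... | no  _ = inj₁ a₀
  attachJ (inj₂ _) = inj₁ a₀

  attach : Fin k → V → V
  attach t with t ≟ᶠ j
  ... | yes _ = attachJ
  ... | no  _ = attachI t

  φ-pick : ∀ {i} → i ≢ j → ∀ b → φ (pick i b) ≡ i
  φ-pick i≢j true  = φ-left _
  φ-pick i≢j false = φ-right i≢j

  isLeft-pick : ∀ {l} → l ≢ j → ∀ b → isLeft l (pick l b) ≡ b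
  isLeft-pick {l} l≢j true  = dec-true (left l ≟ᶠ left l) refl
  isLeft-pick {l} l≢j false = dec-false (right l ≟ᶠ left l) (left≢right l≢j ∘ sym)

  pick-not-isLeft : ∀ {i} → i ≢ j → ∀ c → pick i (not (isLeft i c)) ≢ c
  pick-not-isLeft {i} i≢j c with c ≟ᶠ left i
  ... | yes refl   = left≢right i≢j ∘ sym
  ... | no c≢left = c≢left ∘ sym

  side-≢j : ∀ {i l} u → l ≢ j → side i l u ≡ does (l <? i) xor isLeft l u
  side-≢j {i} {l} u l≢j with l ≟ᶠ j
  ... | yes l≡j = ⊥-elim (l≢j l≡j)
  ... | no _    = refl

  order-xor : ∀ {i l : Fin k} → i ≢ l → does (l <? i) xor does (i <? l) ≡ true
  order-xor {i} {l} i≢l with <-cmp i l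
  ... | tri< i<l _ l≮i rewrite dec-true (i <? l) i<l | dec-false (l <? i) l≮i = refl
  ... | tri≈ _ i≡l _   = ⊥-elim (i≢l i≡l)
  ... | tri> i≮l _ l<i rewrite dec-true (l <? i) l<i | dec-false (i <? l) i≮l = refl

  side-twice : ∀ {i l} → i ≢ j → l ≢ j → i ≢ l →
               ∀ c → side i l (pick l (side l i c)) ≡ not (isLeft i c)
  side-twice {i} {l} i≢j l≢j i≢l c = begin
    side i l (pick l (side l i c))                    ≡⟨ side-≢j _ l≢j ⟩
    does (l <? i) xor isLeft l (pick l (side l i c))  ≡⟨ cong (does (l <? i) xor_) (isLeft-pick l≢j _) ⟩
    does (l <? i) xor side l i c                      ≡⟨ cong (does (l <? i) xor_) (side-≢j c i≢j) ⟩
    does (l <? i) xor (does (i <? l) xor isLeft i c)  ≡⟨ sym (xor-assoc (does (l <? i)) (does (i <? l)) (isLeft i c)) ⟩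
    (does (l <? i) xor does (i <? l)) xor isLeft i c  ≡⟨ cong (_xor isLeft i c) (order-xor i≢l) ⟩
    true xor isLeft i c                               ≡⟨ true-xor _ ⟩
    not (isLeft i c)                                  ∎
    where open ≡-Reasoning

  attachI-a₀ : ∀ {i u} → φ u ≡ j → attachI i (inj₁ u) ≡ inj₁ (right i)
  attachI-a₀ {i} {u} φu≡j with φ u ≟ᶠ j
  ... | yes _    = refl
  ... | no φu≢j = ⊥-elim (φu≢j φu≡j)

  attachI-hub : ∀ i → attachI i (inj₂ (hub i)) ≡ inj₁ (left i)
  attachI-hub i with hub i ≟ᶠ hub i
  ... | yes _   = refl
  ... | no h≢h = ⊥-elim (h≢h refl)

  attachJ-inj₂ : ∀ {u y} → attachJ (inj₁ u) ≡ inj₂ y → u ≡ right (φ u) × hub (φ u) ≡ y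
  attachJ-inj₂ {u} eq with u ≟ᶠ right (φ u)
  ... | yes u≡right = u≡right , inj₂-injective eq

  κ-attach : ∀ t v → κ (attach t v) ≡ t
  κ-attach t v with t ≟ᶠ j
  ... | yes refl = κ-attachJ v
    where
    κ-attachJ : ∀ v → κ (attachJ v) ≡ j
    κ-attachJ (inj₂ _) = φa₀
    κ-attachJ (inj₁ u) with u ≟ᶠ right (φ u)
    ... | yes _ = refl
    ... | no  _ = φa₀
  ... | no t≢j = κ-attachI v
    where
    κ-attachI : ∀ v → κ (attachI t v) ≡ t
    κ-attachI (inj₁ u) = φ-pick t≢j (side t (φ u) u)
    κ-attachI (inj₂ x) with x ≟ᶠ hub t
    ... | yes _ = φ-left t
    ... | no  _ = proj₂ (proj₂ (panchromatic x t))

  root-edge : ∀ t v → v ≢ root t → κ v ≡ t → E v (root t)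
  root-edge t (inj₁ u) v≢r _    = v≢r ∘ cong inj₁
  root-edge t (inj₂ x) _   refl = subst (λ a → adj a x ≡ true) (sym left-j) (a₀-adj x)

  attach-edge : ∀ t v → κ v ≢ t → E v (attach t v)
  attach-edge t v κv≢t with t ≟ᶠ j
  ... | yes refl = attachJ-edge v κv≢t
    where
    attachJ-edge : ∀ v → κ v ≢ j → E v (attachJ v)
    attachJ-edge (inj₂ _) κv≢j = ⊥-elim (κv≢j refl)
    attachJ-edge (inj₁ u) φu≢j with u ≟ᶠ right (φ u)
    ... | yes u≡right = subst (λ a → adj a (hub (φ u)) ≡ true) (sym u≡right) (right-adj φu≢j)
    ... | no  _       = λ u≡a₀ → φu≢j (trans (cong φ u≡a₀) φa₀)
  ... | no t≢j = attachI-edge v κv≢t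
    where
    attachI-edge : ∀ v → κ v ≢ t → E v (attachI t v)
    attachI-edge (inj₁ u) φu≢t = λ u≡pick → φu≢t (trans (cong φ u≡pick) (φ-pick t≢j (side t (φ u) u)))
    attachI-edge (inj₂ x) _ with x ≟ᶠ hub t
    ... | yes refl = left-adj t≢j
    ... | no  _    = proj₁ (proj₂ (panchromatic x t))

  attachJ-right : ∀ {i} → i ≢ j → attachJ (inj₁ (right i)) ≡ inj₂ (hub i)
  attachJ-right {i} i≢j with right i ≟ᶠ right (φ (right i))
  ... | yes _ = cong (inj₂ ∘ hub) (φ-right i≢j)
  ... | no r≢r = ⊥-elim (r≢r (cong right (sym (φ-right i≢j))))

  cycle-JI : ∀ {i} → i ≢ j → ∀ v → κ v ≡ j → attachJ (attachI i v) ≢ v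
  cycle-JI {i} i≢j (inj₁ u) φu≡j eq
    with trans (sym (attachJ-right i≢j)) (trans (cong attachJ (sym (attachI-a₀ φu≡j))) eq)
  ... | ()
  cycle-JI {i} i≢j (inj₂ x) _ with x ≟ᶠ hub i
  ... | yes refl = λ eq →
          left≢right i≢j (trans (proj₁ (attachJ-inj₂ eq)) (cong right (φ-left i)))
  ... | no x≢hub = λ eq →
          x≢hub (sym (trans (cong hub (sym (proj₂ (proj₂ (panchromatic x i)))))
                            (proj₂ (attachJ-inj₂ eq))))

  cycle-IJ : ∀ {i} → i ≢ j → ∀ v → κ v ≡ i → attachI i (attachJ v) ≢ v
  cycle-IJ i≢j (inj₂ _) j≡i = ⊥-elim (i≢j (sym j≡i))
  cycle-IJ i≢j (inj₁ c) refl with c ≟ᶠ right (φ c)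
  ... | yes c≡right = λ eq →
          left≢right i≢j (trans (inj₁-injective (trans (sym (attachI-hub (φ c))) eq)) c≡right)
  ... | no c≢right  = λ eq → c≢right (sym (inj₁-injective (trans (sym (attachI-a₀ φa₀)) eq)))

  cycle-II : ∀ {i l} → i ≢ j → l ≢ j → i ≢ l → ∀ v → κ v ≡ i → attachI i (attachI l v) ≢ v
  cycle-II i≢j _ _ (inj₂ _) j≡i = ⊥-elim (i≢j (sym j≡i))
  cycle-II {l = l} i≢j l≢j i≢l (inj₁ c) refl eq =
    pick-not-isLeft i≢j c (inj₁-injective (trans (sym twice) eq))
    where
    twice : attachI (φ c) (attachI l (inj₁ c)) ≡ inj₁ (pick (φ c) (not (isLeft (φ c) c)))
    twice = cong (inj₁ ∘ pick (φ c))
      (trans (cong (λ l′ → side (φ c) l′ (pick l (side l (φ c) c))) (φ-pick l≢j (side l (φ c) c)))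
             (side-twice i≢j l≢j i≢l c))

  no-2-cycle : ∀ t s v → t ≢ s → κ v ≡ t → attach t (attach s v) ≢ v
  no-2-cycle t s v t≢s κv≡t with t ≟ᶠ j | s ≟ᶠ j
  ... | yes refl | yes refl = ⊥-elim (t≢s refl)
  ... | yes refl | no s≢j   = cycle-JI s≢j v κv≡t
  ... | no t≢j   | yes refl = cycle-IJ t≢j v κv≡t
  ... | no t≢j   | no s≢j   = cycle-II t≢j s≢j t≢s v κv≡t

  open ColourClassTrees (≡-dec _≟ᶠ_ _≟ᶠ_) κ root κ-root attach κ-attach

  hasCIST : HasCIST k E
  hasCIST = (λ t → TreeEdge (tree t)) ,
            completelyIndependentClasses E E-sym root-edge attach-edge no-2-cycle

proposition2 : (k : ℕ) → 2 ≤ k →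
    (d m : ℕ) (adj : Fin d → Fin m → Bool) →
    EveryDHasINeighbour adj →
    ¬ KUniform k adj →
    (φ : Fin d → Fin k) → Panchromatic adj φ →
    (j : Fin k) → UniqueColour φ j →
    (∀ (c : Fin k) → c ≢ j → ¬ UniqueColour φ c) →
    (∀ (i : Fin k) → i ≢ j →
       ∃[ y ] (k < degI adj y ×
         ∃[ a ] ∃[ b ] (a ≢ b × adj a y ≡ true × adj b y ≡ true × φ a ≡ i × φ b ≡ i))) →
    HasCIST k (SEdge adj)
proposition2 k _ d m adj D-has-I-neighbour _ φ panchromatic j (a₀ , φa₀ , a₀-only) _ hubs =
  SplitGraphTrees.hasCIST adj φ panchromatic j a₀ φa₀ a₀-only
    (proj₁ (D-has-I-neighbour a₀)) (λ i i≢j → map₂ proj₂ (hubs i i≢j))
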